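{- Let $Sys=(V,I,T)$ be a Boolean transition system and $P$ a safety property. The Forward CAR framework described in the context, run on $Sys$ and $P$ (with any choices of the partial assignments, minimal unsatisfiable cores and indices $k$ it uses), terminates, and its output is correct: it returns "unsafe" if and only if $Sys$ is unsafe for $P$, and "safe" if and only if $Sys$ is safe for $P$.
   Context: A Boolean transition system is $Sys=(V,I,T)$: $V$ a finite set of Boolean variables, states are assignments in $2^V$, $I$ a formula over $V$ (initial states), $T$ a formula over $V\cup V'$ ($V'$ a primed copy) with $(s_1,s_2)\in T$ iff $s_1\cup s_2'\models T$. Formulas over $V$ are identified with their sets of states; $\psi(x)$ and $\psi'(x')$ denote a formula and its primed copy. $R(X)=\{s'\mid (s,s')\in T, s\in X\}$, $R^{ -1}(X)=\{s\mid(s,s')\in T, s'\in X\}$. $Sys$ is safe for $P$ if every state reachable (via a finite path of transitions, possibly of length zero) from an initial state satisfies $P$, and unsafe otherwise. A cube is a conjunction of literals, a clause a disjunction. For a satisfiable CNF formula $\phi$ over $V\cup V'$, a partial assignment is a set of literals $A^p$ contained in some satisfying assignment such that every full assignment extending $A^p$ satisfies $\phi$; $pa(\phi)|_x$ denotes the cube consisting of the literals over $V$ of such a partial assignment. For an unsatisfiable CNF formula $\phi=\psi\wedge c'$ where the cube $c'$ is viewed as a set of unit clauses, a minimal unsatisfiable core is a subset $C$ of the clauses that is unsatisfiable while every proper subset is satisfiable; $muc(\phi)|_{c'}$ denotes the cube formed by the unit clauses of $c'$ lying in such a core, taken unprimed. The framework maintains frames $F_0,F_1,\ldots$ (CNF,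 sets of clauses) and $B_0,B_1,\ldots$ (DNF, sets of cubes), with $S(F)=\bigcup_m F_m$ and $S(B)=\bigcup_m B_m$ (as state sets, always referring to the current frames). Forward CAR: (1) set $B_0=\neg P$, $F_0=I$. (2) If $F_0\cap B_0\neq\emptyset$ or $R(F_0)\cap B_0\neq\emptyset$, return unsafe. (3) For $i=1,2,\ldots$: (a) set $F_i:=P$; (b) while $S(F)\cap R^{ -1}(S(B))\neq\emptyset$: (i) let $j$ be the minimal index such that $F_j\cap R^{ -1}(B_k)\neq\emptyset$ for some $k\geq0$ (and fix such $k$); (ii) if $j=0$ return unsafe; (iii) let $c_1=pa(F_j(x)\wedge T(x,x')\wedge B_k'(x'))|_x$; (iv) add the cube $c_1$ to $B_{k+1}$ (creating $B_{k+1}=\{c_1\}$ if it does not exist); (v) let $\phi=F_{j-1}(x)\wedge T(x,x')\wedge c_1'(x')$; (vi) if $\phi$ is satisfiable, let $c_2=pa(\phi)|_x$ and add $c_2$ to $B_{k+2}$ (creating it if needed); (vii) if $\phi$ is unsatisfiable, let $c_2=muc(\phi)|_{c_1'}$ and add the clause $\neg c_2$ to $F_j$. (c) If there is $0\leq j\leq i$ with $F_j\subseteq\bigcup_{0\leq m\leq j-1}F_m$, return safe. (d) Continue with $i+1$. -}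

module Defs where

open import Data.Nat using (ℕ; zero; suc; _≤_; _<_; _≟_; _+_)
open import Data.Fin using (Fin)
open import Data.Bool using (Bool; not)
open import Data.Product using (Σ; ∃; ∃-syntax; _×_; _,_)
open import Data.Sum using (_⊎_; inj₁; inj₂)
open import Data.Maybe using (Maybe; just; nothing)
open import Data.List using (List; []; _∷_; map; mapMaybe; _++_)
open import Data.List.Relation.Unary.All using (All)
open import Data.List.Relation.Unary.Any using (Any)
open import Data.List.Membership.Propositional using (_∈_)
open import Data.List.Relation.Binary.Subset.Propositional using (_⊆_)
open import Relation.Nullary using (¬_; yes; no)
open import Relation.Binary.PropositionalEquality using (_≡_)
open import Function.Bundles using (_⇔_)

-- a literal (x , b): variable x with polarity b (true = positive literal x)
Lit : Set → Set
Lit X = X × Bool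

Clause : Set → Set
Clause X = List (Lit X)

Cube : Set → Set
Cube X = List (Lit X)

CNF : Set → Set
CNF X = List (Clause X)

DNF : Set → Set
DNF X = List (Cube X)

Assignment : Set → Set
Assignment X = X → Bool

litSat : {X : Set} → Assignment X → Lit X → Set
litSat a (x , b) = a x ≡ b

clauseSat : {X : Set} → Assignment X → Clause X → Set
clauseSat a c = Any (litSat a) c

cubeSat : {X : Set} → Assignment X → Cube X → Set
cubeSat a c = All (litSat a) c

cnfSat : {X : Set} → Assignment X → CNF X → Set
cnfSat a φ = All (clauseSat a) φ

dnfSat : {X : Set} → Assignment X → DNF X → Set
dnfSat a φ = Any (cubeSat a) φ

negLit : {X : Set} → Lit X → Lit X
negLit (x , b) = (x , not b)

negCube : {X : Set} → Cube X → Clause X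
negCube c = map negLit c

negCNF : {X : Set} → CNF X → DNF X
negCNF φ = map negCube φ

renLit : {X Y : Set} → (X → Y) → Lit X → Lit Y
renLit f (x , b) = (f x , b)

-- Variables V = Fin n, and V ∪ V' = Fin n ⊎ Fin n
-- (inj₁ x is the unprimed x, inj₂ x is the primed copy x')

State : ℕ → Set
State n = Assignment (Fin n)

VV' : ℕ → Set
VV' n = Fin n ⊎ Fin n

join : {n : ℕ} → State n → State n → Assignment (VV' n)
join s t (inj₁ x) = s x
join s t (inj₂ x) = t x

unprimedPart : {n : ℕ} → Assignment (VV' n) → State n
unprimedPart a x = a (inj₁ x)

primedPart : {n : ℕ} → Assignment (VV' n) → State n
primedPart a x = a (inj₂ x)

restrictX : {n : ℕ} → List (Lit (VV' n)) → Cube (Fin n)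
restrictX = mapMaybe f
  where
  f : _ → Maybe _
  f (inj₁ x , b) = just (x , b)
  f (inj₂ x , b) = nothing

unprimeCNF : {n : ℕ} → CNF (Fin n) → CNF (VV' n)
unprimeCNF φ = map (map (renLit inj₁)) φ

primedUnits : {n : ℕ} → Cube (Fin n) → CNF (VV' n)
primedUnits c = map (λ l → renLit inj₂ l ∷ []) c

-- A^p is a partial assignment of the formula φ (given semantically as a
-- predicate on full assignments): it is contained in some satisfying
-- assignment, and every full assignment extending it satisfies φ.
IsPartialAssignment : {X : Set} → (Assignment X → Set) → List (Lit X) → Set
IsPartialAssignment {X} φ Ap =
  (Σ (Assignment X) λ a → φ a × All (litSat a) Ap) ×
  ((a : Assignment X) → All (litSat a) Ap → φ a)

SatCNF : {X : Set} → CNF X → Set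
SatCNF {X} φ = Σ (Assignment X) λ a → cnfSat a φ

IsMUC : {X : Set} → CNF X → CNF X → Set
IsMUC φ C =
  C ⊆ φ × ¬ SatCNF C ×
  ((D : _) → D ⊆ C → ¬ (C ⊆ D) → SatCNF D)

data Result : Set where
  safe unsafe : Result

data Phase : Set where
  start    : Phase
  newFrame : Phase   -- steps (3)(d),(3)(a): i := i+1, F_i := P
  loop     : Phase
  fixCheck : Phase

upd : {A : Set} → (ℕ → A) → ℕ → A → ℕ → A
upd f k v m with m ≟ k
... | yes _ = v
... | no  _ = f m

-- frames: F m for 0 ≤ m ≤ i are the existing F-frames; B m is B_m,
-- a frame that has not been created being the empty DNF (false)
record Run (n : ℕ) : Set where
  constructor run
  field
    i     : ℕ
    F     : ℕ → CNF (Fin n)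
    B     : ℕ → DNF (Fin n)
    phase : Phase

data Config (n : ℕ) : Set where
  running : Run n → Config n
  halted  : Result → Config n

module CAR {n : ℕ} (I : CNF (Fin n)) (T : CNF (VV' n)) (P : CNF (Fin n)) where

  Trans : State n → State n → Set
  Trans s t = cnfSat (join s t) T

  data Reachable : State n → Set where
    init : ∀ {s} → cnfSat s I → Reachable s
    step : ∀ {s t} → Reachable s → Trans s t → Reachable t

  Safe : Set
  Safe = (s : State n) → Reachable s → cnfSat s P

  NotSafe : Set
  NotSafe = ¬ Safe

  initial : Config n
  initial = running (run 0 (λ _ → I) (λ m → upd (λ _ → []) 0 (negCNF P) m) start)

  Hit : (ℕ → CNF (Fin n)) → (ℕ → DNF (Fin n)) → ℕ → ℕ → Set
  Hit F B j k = Σ (State n) λ s → Σ (State n) λ t →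
    cnfSat s (F j) × Trans s t × dnfSat t (B k)

  Overlap : ℕ → (ℕ → CNF (Fin n)) → (ℕ → DNF (Fin n)) → Set
  Overlap i F B = Σ ℕ λ j → Σ ℕ λ k → j ≤ i × Hit F B j k

  φ₁ : CNF (Fin n) → DNF (Fin n) → Assignment (VV' n) → Set
  φ₁ Fj Bk a = cnfSat (unprimedPart a) Fj × cnfSat a T × dnfSat (primedPart a) Bk

  φ₂ : CNF (Fin n) → Cube (Fin n) → Assignment (VV' n) → Set
  φ₂ Fj c a = cnfSat (unprimedPart a) Fj × cnfSat a T × cubeSat (primedPart a) c

  φ₂clauses : CNF (Fin n) → Cube (Fin n) → CNF (VV' n)
  φ₂clauses Fj c = (unprimeCNF Fj ++ T) ++ primedUnits c

  FixPoint : ℕ → (ℕ → CNF (Fin n)) → Set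
  FixPoint i F = Σ ℕ λ j → j ≤ i ×
    ((s : State n) → cnfSat s (F j) → Σ ℕ λ m → m < j × cnfSat s (F m))

  data _⟶_ : Run n → Config n → Set where
    start-unsafe : ∀ {i F B} →
      ((Σ (State n) λ s → cnfSat s (F 0) × dnfSat s (B 0)) ⊎
       (Σ (State n) λ s → Σ (State n) λ t → cnfSat s (F 0) × Trans s t × dnfSat t (B 0))) →
      run i F B start ⟶ halted unsafe
    start-go : ∀ {i F B} →
      ¬ (Σ (State n) λ s → cnfSat s (F 0) × dnfSat s (B 0)) →
      ¬ (Σ (State n) λ s → Σ (State n) λ t → cnfSat s (F 0) × Trans s t × dnfSat t (B 0)) →
      run i F B start ⟶ running (run (suc i) (upd F (suc i) P) B loop)
    new-frame : ∀ {i F B} →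
      run i F B newFrame ⟶ running (run (suc i) (upd F (suc i) P) B loop)
    loop-exit : ∀ {i F B} →
      ¬ Overlap i F B →
      run i F B loop ⟶ running (run i F B fixCheck)
    loop-unsafe : ∀ {i F B} k →
      Hit F B 0 k →
      run i F B loop ⟶ halted unsafe
    loop-sat : ∀ {i F B} j k (A₁ A₂ : List (Lit (VV' n))) →
      suc j ≤ i → Hit F B (suc j) k →
      ((j' k' : ℕ) → j' < suc j → ¬ Hit F B j' k') →
      IsPartialAssignment (φ₁ (F (suc j)) (B k)) A₁ →
      let c₁ = restrictX A₁
          B' = upd B (suc k) (c₁ ∷ B (suc k)) in
      IsPartialAssignment (φ₂ (F j) c₁) A₂ →
      let c₂ = restrictX A₂ in
      run i F B loop ⟶ running (run i F (upd B' (suc (suc k)) (c₂ ∷ B' (suc (suc k)))) loop)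
    loop-unsat : ∀ {i F B} j k (A₁ : List (Lit (VV' n))) (C : CNF (VV' n)) (c₂ : Cube (Fin n)) →
      suc j ≤ i → Hit F B (suc j) k →
      ((j' k' : ℕ) → j' < suc j → ¬ Hit F B j' k') →
      IsPartialAssignment (φ₁ (F (suc j)) (B k)) A₁ →
      let c₁ = restrictX A₁
          B' = upd B (suc k) (c₁ ∷ B (suc k)) in
      ¬ (Σ (Assignment (VV' n)) λ a → φ₂ (F j) c₁ a) →
      IsMUC (φ₂clauses (F j) c₁) C →
      ((l : Lit (Fin n)) → (l ∈ c₂) ⇔ (l ∈ c₁ × (renLit inj₂ l ∷ []) ∈ C)) →
      run i F B loop ⟶
        running (run i (upd F (suc j) (negCube c₂ ∷ F (suc j))) B' loop)
    fix-safe : ∀ {i F B} →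
      FixPoint i F →
      run i F B fixCheck ⟶ halted safe
    fix-go : ∀ {i F B} →
      ¬ FixPoint i F →
      run i F B fixCheck ⟶ running (run i F B newFrame)

  Correct : Result → Set
  Correct r = ((r ≡ unsafe) ⇔ NotSafe) × ((r ≡ safe) ⇔ Safe)

data AllRunsTerminate {n : ℕ} (Step : Run n → Config n → Set)
                      (Good : Result → Set) : Config n → Set where
  halt : ∀ {r} → Good r → AllRunsTerminate Step Good (halted r)
  go   : ∀ {c} → (Σ (Config n) λ c' → Step c c') →
         (∀ {c'} → Step c c' → AllRunsTerminate Step Good c') →
         AllRunsTerminate Step Good (running c)

module Submission where

-- Each configuration of a run carries a certificate (module Certified):
--  * an invariant (F_0 = I, F_m ⊆ P, R(F_m) ⊆ F_{m+1}, ¬P ⊆ B_0, all states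
--    of all B_k reach ¬P), by which an "unsafe" answer exhibits a reachable
--    bad state and a fixpoint F_j ⊆ ⋃_{m<j} F_m covers the reachable states;
--  * a measure in ℕ³ that decreases lexicographically at every step:
--    2^n ∸ i (without a fixpoint the unions ⋃_{m<j} F_m grow strictly), the
--    number of states in F_0, …, F_i (blocking removes one), and the rank of
--    the phase, bounded in the loop by the least overlapping frame.
-- Certified configurations can always step: all choices exist (models are
-- partial assignments, minimal cores come from greedy deletion) and all
-- tests are decided over the 2^n states.

open import Defs
open import Data.Nat using (ℕ; zero; suc; _+_; _∸_; _≤_; _<_; _^_; z≤n; s≤s)
open import Data.Nat.Properties
open import Data.Nat.Induction using (<-wellFounded)
open import Induction.WellFounded using (WellFounded; Acc; acc)
open import Data.Product.Relation.Binary.Lex.Strict using (×-Lex; ×-wellFounded)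
open import Data.Fin using (Fin) renaming (zero to fz; suc to fsuc)
open import Data.Fin.Properties using () renaming (_≟_ to _≟f_)
open import Data.Bool using (Bool; true; false)
open import Data.Bool.Properties using (not-¬; ¬-not) renaming (_≟_ to _≟b_)
open import Data.Product using (Σ; _×_; _,_; proj₁)
open import Data.Sum using (_⊎_; inj₁; inj₂; [_,_]′)
open import Function.Bundles using (_⇔_; mk⇔; Equivalence)
open import Function.Base using (id)
open import Data.Empty using (⊥; ⊥-elim)
open import Data.List using (List; []; _∷_; map; filter; length; _++_; allFin)
open import Data.List.Properties using (filter-notAll) renaming (≡-dec to List-≡-dec)
open import Data.Product.Properties using () renaming (≡-dec to ×-≡-dec)
open import Data.Sum.Properties using () renaming (≡-dec to ⊎-≡-dec)
open import Data.List.Membership.Propositional using (_∈_; find; lose)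
open import Data.List.Membership.Propositional.Properties
  using (∈-filter⁺; ∈-filter⁻; ∈-map⁺; ∈-map⁻; ∈-++⁺ˡ; ∈-++⁺ʳ; ∈-++⁻; ∈-allFin)
open import Data.List.Relation.Unary.All.Properties.Core using (¬All⇒Any¬)
import Data.List.Relation.Unary.All.Properties as All
open import Data.List.Relation.Binary.Subset.Propositional using (_⊆_)
open import Data.List.Relation.Unary.All as All using (All; []; _∷_)
open import Data.List.Relation.Unary.Any as Any using (Any; here; there)
import Data.List.Relation.Unary.Any.Properties as Any
open import Relation.Nullary using (¬_; Dec; yes; no; ¬?)
open import Relation.Nullary.Decidable using (decidable-stable; _×-dec_)
open import Relation.Binary.Definitions using (DecidableEquality)
open import Relation.Binary.PropositionalEquality using (_≡_; _≢_; _≗_; refl; sym; trans; subst)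

-- Satisfaction only depends on the values of the assignment, so it is
-- invariant under pointwise equality (states are functions, and there is
-- no function extensionality).
module _ {X : Set} {a b : Assignment X} (a≗b : a ≗ b) where
  litSat-resp : ∀ {l} → litSat a l → litSat b l
  litSat-resp {x , v} p = trans (sym (a≗b x)) p

  clauseSat-resp : ∀ {c} → clauseSat a c → clauseSat b c
  clauseSat-resp = Any.map litSat-resp

  cubeSat-resp : ∀ {c} → cubeSat a c → cubeSat b c
  cubeSat-resp = All.map litSat-resp

  cnfSat-resp : ∀ {φ} → cnfSat a φ → cnfSat b φ
  cnfSat-resp = All.map clauseSat-resp

  dnfSat-resp : ∀ {φ} → dnfSat a φ → dnfSat b φ
  dnfSat-resp = Any.map cubeSat-resp

module _ {X : Set} (a : Assignment X) where
  litSat? : ∀ l → Dec (litSat a l)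
  litSat? (x , v) = a x ≟b v

  clauseSat? : ∀ c → Dec (clauseSat a c)
  clauseSat? = Any.any? litSat?

  cubeSat? : ∀ c → Dec (cubeSat a c)
  cubeSat? = All.all? litSat?

  cnfSat? : ∀ φ → Dec (cnfSat a φ)
  cnfSat? = All.all? clauseSat?

  dnfSat? : ∀ φ → Dec (dnfSat a φ)
  dnfSat? = Any.any? cubeSat?

module _ {X : Set} (a : Assignment X) where
  cube⇒¬negCube : ∀ c → cubeSat a c → ¬ clauseSat a (negCube c)
  cube⇒¬negCube ((x , v) ∷ c) (p ∷ _)  (here q)  = not-¬ p q
  cube⇒¬negCube (_ ∷ c)       (_ ∷ ps) (there q) = cube⇒¬negCube c ps q

  ¬cube⇒negCube : ∀ c → ¬ cubeSat a c → clauseSat a (negCube c)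
  ¬cube⇒negCube []            ¬c = ⊥-elim (¬c [])
  ¬cube⇒negCube ((x , v) ∷ c) ¬c with a x ≟b v
  ... | yes p = there (¬cube⇒negCube c (λ ps → ¬c (p ∷ ps)))
  ... | no ¬p = here (¬-not ¬p)

  negCube⇒¬clause : ∀ c → cubeSat a (negCube c) → ¬ clauseSat a c
  negCube⇒¬clause ((x , v) ∷ c) (p ∷ _)  (here q)  = not-¬ q p
  negCube⇒¬clause (_ ∷ c)       (_ ∷ ps) (there q) = negCube⇒¬clause c ps q

  ¬clause⇒negCube : ∀ c → ¬ clauseSat a c → cubeSat a (negCube c)
  ¬clause⇒negCube []            _  = []
  ¬clause⇒negCube ((x , v) ∷ c) ¬c =
    ¬-not (λ p → ¬c (here p)) ∷ ¬clause⇒negCube c (λ q → ¬c (there q))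

  negCNF⇒¬cnf : ∀ φ → dnfSat a (negCNF φ) → ¬ cnfSat a φ
  negCNF⇒¬cnf (c ∷ _) (here q)  (p ∷ _)  = negCube⇒¬clause c q p
  negCNF⇒¬cnf (_ ∷ φ) (there q) (_ ∷ ps) = negCNF⇒¬cnf φ q ps

  ¬cnf⇒negCNF : ∀ φ → ¬ cnfSat a φ → dnfSat a (negCNF φ)
  ¬cnf⇒negCNF []      ¬φ = ⊥-elim (¬φ [])
  ¬cnf⇒negCNF (c ∷ φ) ¬φ with clauseSat? a c
  ... | yes p = there (¬cnf⇒negCNF φ (λ ps → ¬φ (p ∷ ps)))
  ... | no ¬p = here (¬clause⇒negCube c ¬p)

Resp : ∀ {n} → (State n → Set) → Set
Resp Q = ∀ {s s'} → s ≗ s' → Q s → Q s'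

_◂_ : ∀ {n} → Bool → State n → State (suc n)
(b ◂ s) fz       = b
(b ◂ s) (fsuc x) = s x

tail : ∀ {n} → State (suc n) → State n
tail s x = s (fsuc x)

◂-tail : ∀ {n b} (s : State (suc n)) → s fz ≡ b → s ≗ b ◂ tail s
◂-tail s eq fz       = eq
◂-tail s eq (fsuc x) = refl

at : ∀ {n} → Bool → (State (suc n) → Set) → State n → Set
at b Q s = Q (b ◂ s)

at-resp : ∀ {n} {Q : State (suc n) → Set} b → Resp Q → Resp (at b Q)
at-resp b resp s≗s' = resp λ { fz → refl ; (fsuc x) → s≗s' x }

empty : State 0
empty ()

∃-state? : ∀ n (Q : State n → Set) → Resp Q → (∀ s → Dec (Q s)) → Dec (Σ (State n) Q)
∃-state? zero Q resp Q? with Q? empty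
... | yes q = yes (empty , q)
... | no ¬q = no λ (s , q) → ¬q (resp (λ ()) q)
∃-state? (suc n) Q resp Q?
  with ∃-state? n (at false Q) (at-resp false resp) (λ s → Q? _)
     | ∃-state? n (at true Q) (at-resp true resp) (λ s → Q? _)
... | yes (s , q) | _           = yes (_ , q)
... | no _        | yes (s , q) = yes (_ , q)
... | no ¬f       | no ¬t       = no λ (s , q) → split s q
  where
  split : ∀ s → Q s → ⊥
  split s q with s fz in eq
  ... | false = ¬f (tail s , resp (◂-tail s eq) q)
  ... | true  = ¬t (tail s , resp (◂-tail s eq) q)

count : ∀ n (Q : State n → Set) → (∀ s → Dec (Q s)) → ℕ
count zero Q Q? with Q? empty
... | yes _ = 1
... | no  _ = 0
count (suc n) Q Q? = count n (at false Q) (λ s → Q? _) + count n (at true Q) (λ s → Q? _)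

count-≤ : ∀ n Q Q? → count n Q Q? ≤ 2 ^ n
count-≤ zero Q Q? with Q? empty
... | yes _ = ≤-refl
... | no  _ = z≤n
count-≤ (suc n) Q Q? rewrite +-identityʳ (2 ^ n) =
  +-mono-≤ (count-≤ n _ (λ s → Q? _)) (count-≤ n _ (λ s → Q? _))

count-mono : ∀ n Q Q? Q' Q'? → (∀ s → Q s → Q' s) → count n Q Q? ≤ count n Q' Q'?
count-mono zero Q Q? Q' Q'? Q⊆Q' with Q? empty | Q'? empty
... | yes q | yes _  = ≤-refl
... | yes q | no ¬q' = ⊥-elim (¬q' (Q⊆Q' _ q))
... | no _  | _      = z≤n
count-mono (suc n) Q Q? Q' Q'? Q⊆Q' =
  +-mono-≤ (count-mono n _ (λ s → Q? _) _ (λ s → Q'? _) (λ s → Q⊆Q' _))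
           (count-mono n _ (λ s → Q? _) _ (λ s → Q'? _) (λ s → Q⊆Q' _))

count-strict : ∀ n Q Q? Q' Q'? → Resp Q → Resp Q' → (∀ s → Q s → Q' s) →
               (s : State n) → Q' s → ¬ Q s → count n Q Q? < count n Q' Q'?
count-strict zero Q Q? Q' Q'? resp resp' Q⊆Q' s q' ¬q with Q? empty | Q'? empty
... | yes q | _      = ⊥-elim (¬q (resp (λ ()) q))
... | no _  | yes _  = s≤s z≤n
... | no _  | no ¬q' = ⊥-elim (¬q' (resp' (λ ()) q'))
count-strict (suc n) Q Q? Q' Q'? resp resp' Q⊆Q' s q' ¬q = bySign (s fz) refl
  where
  mono : ∀ b → count n (at b Q) (λ s → Q? _) ≤ count n (at b Q') (λ s → Q'? _)
  mono b = count-mono n _ (λ s → Q? _) _ (λ s → Q'? _) (λ s → Q⊆Q' _)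

  strict : ∀ b → s fz ≡ b → count n (at b Q) (λ s → Q? _) < count n (at b Q') (λ s → Q'? _)
  strict b eq = count-strict n _ (λ s → Q? _) _ (λ s → Q'? _) (at-resp b resp) (at-resp b resp')
    (λ s → Q⊆Q' _) (tail s) (resp' (◂-tail s eq) q') (λ q → ¬q (resp (λ x → sym (◂-tail s eq x)) q))

  bySign : ∀ b → s fz ≡ b → count (suc n) Q Q? < count (suc n) Q' Q'?
  bySign false eq = +-mono-<-≤ (strict false eq) (mono true)
  bySign true  eq = +-mono-≤-< (mono false) (strict true eq)

Least : (ℕ → Set) → ℕ → Set
Least Q j = Q j × (∀ j' → j' < j → ¬ Q j')

least? : {Q : ℕ → Set} → (∀ j → Dec (Q j)) → ∀ i →
         (Σ ℕ λ j → j ≤ i × Least Q j) ⊎ (∀ j → j ≤ i → ¬ Q j)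
least? Q? zero with Q? 0
... | yes q = inj₁ (0 , z≤n , q , λ _ ())
... | no ¬q = inj₂ λ { .zero z≤n → ¬q }
least? Q? (suc i) with least? Q? i
... | inj₁ (j , j≤i , lq) = inj₁ (j , m≤n⇒m≤1+n j≤i , lq)
... | inj₂ none with Q? (suc i)
...   | yes q = inj₁ (suc i , ≤-refl , q , λ j' j'<1+i → none j' (≤-pred j'<1+i))
...   | no ¬q = inj₂ λ j j≤1+i →
          [ (λ j<1+i → none j (≤-pred j<1+i)) , (λ { refl → ¬q }) ]′ (m≤n⇒m<n∨m≡n j≤1+i)

sumUpTo : ℕ → (ℕ → ℕ) → ℕ
sumUpTo zero    f = f 0
sumUpTo (suc i) f = sumUpTo i f + f (suc i)

sumUpTo-mono : ∀ i g f → (∀ m → m ≤ i → g m ≤ f m) → sumUpTo i g ≤ sumUpTo i f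
sumUpTo-mono zero    g f g≤f = g≤f 0 z≤n
sumUpTo-mono (suc i) g f g≤f =
  +-mono-≤ (sumUpTo-mono i g f (λ m m≤i → g≤f m (m≤n⇒m≤1+n m≤i))) (g≤f (suc i) ≤-refl)

sumUpTo-strict : ∀ i g f → (∀ m → m ≤ i → g m ≤ f m) →
                 ∀ m₀ → m₀ ≤ i → g m₀ < f m₀ → sumUpTo i g < sumUpTo i f
sumUpTo-strict zero g f g≤f .zero z≤n g<f = g<f
sumUpTo-strict (suc i) g f g≤f m₀ m₀≤1+i g<f = byPosition (m≤n⇒m<n∨m≡n m₀≤1+i)
  where
  g≤f-below : ∀ m → m ≤ i → g m ≤ f m
  g≤f-below m m≤i = g≤f m (m≤n⇒m≤1+n m≤i)

  byPosition : m₀ < suc i ⊎ m₀ ≡ suc i → sumUpTo (suc i) g < sumUpTo (suc i) f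
  byPosition (inj₁ m₀<1+i) =
    +-mono-<-≤ (sumUpTo-strict i g f g≤f-below m₀ (≤-pred m₀<1+i) g<f) (g≤f (suc i) ≤-refl)
  byPosition (inj₂ refl) = +-mono-≤-< (sumUpTo-mono i g f g≤f-below) g<f

IsMUC-⊆ : {X : Set} {φ ψ C : CNF X} → φ ⊆ ψ → IsMUC φ C → IsMUC ψ C
IsMUC-⊆ φ⊆ψ (C⊆φ , unsat , minimal) = (λ c∈C → φ⊆ψ (C⊆φ c∈C)) , unsat , minimal

-- Every unsatisfiable clause set has a minimal unsatisfiable core, as long
-- as satisfiability of clause sets is decidable: drop clauses whose
-- removal keeps the set unsatisfiable until no such clause remains.
module _ {X : Set} (_≟c_ : DecidableEquality (Clause X)) (sat? : ∀ D → Dec (SatCNF {X} D)) where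
  open import Data.List.Membership.DecPropositional _≟c_ using (_∈?_)

  without : Clause X → CNF X → CNF X
  without c = filter (λ d → ¬? (d ≟c c))

  irreducible-core : ∀ C → ¬ SatCNF C → (∀ {c} → c ∈ C → SatCNF (without c C)) → IsMUC C C
  irreducible-core C unsat drop-sat = (λ c∈C → c∈C) , unsat , minimal
    where
    minimal : ∀ D → D ⊆ C → ¬ (C ⊆ D) → SatCNF D
    minimal D D⊆C C⊈D with All.all? (_∈? D) C
    ... | yes C⊆D = ⊥-elim (C⊈D (All.lookup C⊆D))
    ... | no C⊈D' with find (¬All⇒Any¬ (_∈? D) C C⊈D')
    ...   | c , c∈C , c∉D with drop-sat c∈C
    ...     | a , sat = a , All.tabulate λ d∈D →
                All.lookup sat (∈-filter⁺ (λ d → ¬? (d ≟c c)) (D⊆C d∈D) λ { refl → c∉D d∈D })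

  without-shorter : ∀ {c C} → c ∈ C → length (without c C) < length C
  without-shorter {c} {C} c∈C = filter-notAll (λ d → ¬? (d ≟c c)) C (lose c∈C λ c≢c → c≢c refl)

  without-⊆ : ∀ c C → without c C ⊆ C
  without-⊆ c C d∈ = proj₁ (∈-filter⁻ (λ d → ¬? (d ≟c c)) d∈)

  muc-bounded : ∀ bound C → length C < bound → ¬ SatCNF C → Σ (CNF X) (IsMUC C)
  muc-bounded (suc bound) C |C|<bound unsat with Any.any? (λ c → ¬? (sat? (without c C))) C
  ... | no none = C , irreducible-core C unsat λ c∈C →
          decidable-stable (sat? _) λ ¬sat → none (lose c∈C ¬sat)
  ... | yes some with find some
  ...   | c , c∈C , unsat'
    with muc-bounded bound (without c C) (<-≤-trans (without-shorter c∈C) (≤-pred |C|<bound)) unsat'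
  ...     | core , is-core = core , IsMUC-⊆ (without-⊆ c C) is-core

  muc : ∀ C → ¬ SatCNF C → Σ (CNF X) (IsMUC C)
  muc C = muc-bounded (suc (length C)) C ≤-refl

upd-≡ : {A : Set} (f : ℕ → A) (k : ℕ) (v : A) → upd f k v k ≡ v
upd-≡ f k v with k ≟ k
... | yes _   = refl
... | no k≢k = ⊥-elim (k≢k refl)

upd-≢ : {A : Set} (f : ℕ → A) (k : ℕ) (v : A) (m : ℕ) → m ≢ k → upd f k v m ≡ f m
upd-≢ f k v m m≢k with m ≟ k
... | yes m≡k = ⊥-elim (m≢k m≡k)
... | no _    = refl

-- Adding x to the k-th list of a sequence of lists: this is how CAR adds a
-- cube to B_k (a disjunction, so Any) or a clause to F_k (a conjunction, so All).
push : {A : Set} → (ℕ → List A) → ℕ → A → ℕ → List A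
push f k x = upd f k (x ∷ f k)

module _ {A : Set} {P : A → Set} (f : ℕ → List A) (k : ℕ) (x : A) where
  push-any⁺ : ∀ m → Any P (f m) → Any P (push f k x m)
  push-any⁺ m p with m ≟ k
  ... | yes refl = there p
  ... | no _     = p

  push-here : P x → Any P (push f k x k)
  push-here p = subst (Any P) (sym (upd-≡ f k (x ∷ f k))) (here p)

  push-all-here : All P (push f k x k) → P x
  push-all-here ps = All.head (subst (All P) (upd-≡ f k (x ∷ f k)) ps)

  push-any⁻ : ∀ m → Any P (push f k x m) → P x ⊎ Any P (f m)
  push-any⁻ m p with m ≟ k
  push-any⁻ m (here q)  | yes refl = inj₁ q
  push-any⁻ m (there p) | yes refl = inj₂ p
  ... | no _ = inj₂ p

  push-all⁺ : ∀ m → (m ≡ k → P x) → All P (f m) → All P (push f k x m)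
  push-all⁺ m px ps with m ≟ k
  ... | yes refl = px refl ∷ ps
  ... | no _    = ps

  push-all⁻ : ∀ m → All P (push f k x m) → All P (f m)
  push-all⁻ m ps with m ≟ k
  push-all⁻ m (_ ∷ ps) | yes refl = ps
  ... | no _ = ps

-- A certificate for a running configuration
-- r with measure μ guarantees that r can step and that every step either
-- halts with a good result or reaches a certified configuration of smaller
-- measure.
module Certified {n : ℕ} (Step : Run n → Config n → Set) (Good : Result → Set)
                 {M : Set} (_≺_ : M → M → Set) (Cert : Run n → M → Set) where

  Next : M → Config n → Set
  Next μ (halted r)   = Good r
  Next μ (running r') = Σ M λ μ' → μ' ≺ μ × Cert r' μ'

  module _ (progress : ∀ {r μ} → Cert r μ → Σ (Config n) (Step r))
           (advance  : ∀ {r μ c} → Cert r μ → Step r c → Next μ c) where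
    mutual
      terminates : ∀ {r μ} → Acc _≺_ μ → Cert r μ → AllRunsTerminate Step Good (running r)
      terminates acc-μ cert = go (progress cert) λ step → continue acc-μ (advance cert step)

      continue : ∀ {μ c} → Acc _≺_ μ → Next μ c → AllRunsTerminate Step Good c
      continue {c = halted _}  _         good                = halt good
      continue {c = running _} (acc rec) (_ , μ'≺μ , cert') = terminates (rec μ'≺μ) cert'

Measure : Set
Measure = ℕ × ℕ × ℕ

_<ₘ_ : Measure → Measure → Set
_<ₘ_ = ×-Lex _≡_ _<_ (×-Lex _≡_ _<_ _<_)

<ₘ-wellFounded : WellFounded _<ₘ_
<ₘ-wellFounded = ×-wellFounded <-wellFounded (×-wellFounded <-wellFounded <-wellFounded)

module _ {n : ℕ} where
  join-η : (a : Assignment (VV' n)) → a ≗ join (unprimedPart a) (primedPart a)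
  join-η a (inj₁ x) = refl
  join-η a (inj₂ x) = refl

  join-resp : {s s' t t' : State n} → s ≗ s' → t ≗ t' → join s t ≗ join s' t'
  join-resp s≗s' t≗t' (inj₁ x) = s≗s' x
  join-resp s≗s' t≗t' (inj₂ x) = t≗t' x

  ∃-pair? : (Q : State n → State n → Set) → (∀ {s s' t t'} → s ≗ s' → t ≗ t' → Q s t → Q s' t') →
            (∀ s t → Dec (Q s t)) → Dec (Σ (State n) λ s → Σ (State n) λ t → Q s t)
  ∃-pair? Q resp Q? = ∃-state? n (λ s → Σ (State n) (Q s))
    (λ s≗s' (t , q) → t , resp s≗s' (λ _ → refl) q)
    (λ s → ∃-state? n (Q s) (resp (λ _ → refl)) (Q? s))

  ∃-assignment? : (Φ : Assignment (VV' n) → Set) → (∀ {a b} → a ≗ b → Φ a → Φ b) →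
                  (∀ a → Dec (Φ a)) → Dec (Σ (Assignment (VV' n)) Φ)
  ∃-assignment? Φ resp Φ?
    with ∃-pair? (λ s t → Φ (join s t)) (λ s≗s' t≗t' → resp (join-resp s≗s' t≗t')) (λ s t → Φ? _)
  ... | yes (s , t , φ) = yes (join s t , φ)
  ... | no ¬φ = no λ (a , φ) → ¬φ (unprimedPart a , primedPart a , resp (join-η a) φ)

  allVars : List (VV' n)
  allVars = map inj₁ (allFin n) ++ map inj₂ (allFin n)

  allVars-complete : ∀ v → v ∈ allVars
  allVars-complete (inj₁ x) = ∈-++⁺ˡ (∈-map⁺ inj₁ (∈-allFin x))
  allVars-complete (inj₂ x) = ∈-++⁺ʳ (map inj₁ (allFin n)) (∈-map⁺ inj₂ (∈-allFin x))

  literals : Assignment (VV' n) → List (Lit (VV' n))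
  literals a = map (λ v → v , a v) allVars

  literals-sat : (a : Assignment (VV' n)) → All (litSat a) (literals a)
  literals-sat a = All.map⁺ (All.tabulate λ _ → refl)

  full-partial : (Φ : Assignment (VV' n) → Set) → (∀ {a b} → a ≗ b → Φ a → Φ b) →
                 ∀ a → Φ a → IsPartialAssignment Φ (literals a)
  full-partial Φ resp a φ = (a , φ , literals-sat a) , λ b b⊨a → resp (λ v → sym (agree b b⊨a v)) φ
    where
    agree : ∀ b → All (litSat b) (literals a) → ∀ v → b v ≡ a v
    agree b b⊨a v = All.lookup b⊨a (∈-map⁺ (λ v → v , a v) (allVars-complete v))

  restrictX-sat : ∀ {a : Assignment (VV' n)} A → All (litSat a) A →
                  cubeSat (unprimedPart a) (restrictX A)
  restrictX-sat []                  []       = []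
  restrictX-sat ((inj₁ x , b) ∷ A) (p ∷ ps) = p ∷ restrictX-sat A ps
  restrictX-sat ((inj₂ x , b) ∷ A) (p ∷ ps) = restrictX-sat A ps

  restrictX-join : ∀ {a : Assignment (VV' n)} {s} A → cubeSat s (restrictX A) → All (litSat a) A →
                   All (litSat (join s (primedPart a))) A
  restrictX-join []                  _        []       = []
  restrictX-join ((inj₁ x , b) ∷ A) (q ∷ qs) (p ∷ ps) = q ∷ restrictX-join A qs ps
  restrictX-join ((inj₂ x , b) ∷ A) qs       (p ∷ ps) = p ∷ restrictX-join A qs ps

  unprimeCNF⁺ : ∀ (a : Assignment (VV' n)) φ → cnfSat (unprimedPart a) φ → cnfSat a (unprimeCNF φ)
  unprimeCNF⁺ a φ sat = All.map⁺ (All.map Any.map⁺ sat)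

  unprimeCNF⁻ : ∀ (a : Assignment (VV' n)) φ → cnfSat a (unprimeCNF φ) → cnfSat (unprimedPart a) φ
  unprimeCNF⁻ a φ sat = All.map Any.map⁻ (All.map⁻ sat)

  primedUnits⁻ : ∀ (a : Assignment (VV' n)) c → cnfSat a (primedUnits c) → cubeSat (primedPart a) c
  primedUnits⁻ a c sat = All.map (λ { (here p) → p }) (All.map⁻ sat)

  satisfiable? : ∀ D → Dec (SatCNF {VV' n} D)
  satisfiable? D = ∃-assignment? (λ a → cnfSat a D) (λ a≗b → cnfSat-resp a≗b) (λ a → cnfSat? a D)

  _≟c_ : DecidableEquality (Clause (VV' n))
  _≟c_ = List-≡-dec (×-≡-dec (⊎-≡-dec _≟f_ _≟f_) _≟b_)

  open import Data.List.Membership.DecPropositional _≟c_ using (_∈?_)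

  coreCube : Cube (Fin n) → CNF (VV' n) → Cube (Fin n)
  coreCube c C = filter (λ l → (renLit inj₂ l ∷ []) ∈? C) c

  coreCube-def : ∀ c C l → (l ∈ coreCube c C) ⇔ (l ∈ c × (renLit inj₂ l ∷ []) ∈ C)
  coreCube-def c C l = mk⇔ (∈-filter⁻ (λ l → (renLit inj₂ l ∷ []) ∈? C))
                           (λ (l∈c , unit∈C) → ∈-filter⁺ (λ l → (renLit inj₂ l ∷ []) ∈? C) l∈c unit∈C)

module ForwardCAR {n : ℕ} (I : CNF (Fin n)) (T : CNF (VV' n)) (P : CNF (Fin n)) where
  open CAR I T P

  Trans-resp : ∀ {s s' t t'} → s ≗ s' → t ≗ t' → Trans s t → Trans s' t'
  Trans-resp s≗s' t≗t' = cnfSat-resp (join-resp s≗s' t≗t')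

  data Doomed : State n → Set where
    now   : ∀ {s} → ¬ cnfSat s P → Doomed s
    later : ∀ {s t} → Trans s t → Doomed t → Doomed s

  doomed-unsafe : ∀ {s} → Reachable s → Doomed s → NotSafe
  doomed-unsafe r (now ¬p)     isSafe = ¬p (isSafe _ r)
  doomed-unsafe r (later tr d) isSafe = doomed-unsafe (step r tr) d isSafe

  unsafe-correct : NotSafe → Correct unsafe
  unsafe-correct notSafe =
    mk⇔ (λ _ → notSafe) (λ _ → refl) , mk⇔ (λ ()) (λ isSafe → ⊥-elim (notSafe isSafe))

  safe-correct : Safe → Correct safe
  safe-correct isSafe =
    mk⇔ (λ ()) (λ notSafe → ⊥-elim (notSafe isSafe)) , mk⇔ (λ _ → isSafe) (λ _ → refl)

  Pre : CNF (Fin n) → (State n → Set) → Assignment (VV' n) → Set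
  Pre Fj Q a = cnfSat (unprimedPart a) Fj × cnfSat a T × Q (primedPart a)

  Pre-resp : ∀ Fj {Q} → Resp Q → ∀ {a b} → a ≗ b → Pre Fj Q a → Pre Fj Q b
  Pre-resp Fj resp a≗b (s∈F , tr , q) =
    cnfSat-resp (λ x → a≗b (inj₁ x)) s∈F , cnfSat-resp a≗b tr , resp (λ x → a≗b (inj₂ x)) q

  Pre? : ∀ Fj {Q} → (∀ t → Dec (Q t)) → ∀ a → Dec (Pre Fj Q a)
  Pre? Fj Q? a = cnfSat? (unprimedPart a) Fj ×-dec cnfSat? a T ×-dec Q? (primedPart a)

  pa-successor : ∀ Fj Q A → IsPartialAssignment (Pre Fj Q) A →
                 ∀ s → cubeSat s (restrictX A) → Σ (State n) λ t → Trans s t × Q t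
  pa-successor Fj Q A ((a , _ , a⊨A) , extends) s s⊨c
    with extends (join s (primedPart a)) (restrictX-join A s⊨c a⊨A)
  ... | _ , tr , q = primedPart a , tr , q

  -- The cube c₂ read off a minimal unsatisfiable core of F_j(x) ∧ T ∧ c₁'
  -- (step (vii)) has no predecessor in F_j, so ¬c₂ may be added to F_{j+1}.
  core-blocks : ∀ Fj c₁ C c₂ → IsMUC (φ₂clauses Fj c₁) C →
                (∀ l → (l ∈ c₂) ⇔ (l ∈ c₁ × (renLit inj₂ l ∷ []) ∈ C)) →
                ∀ s t → cnfSat s Fj → Trans s t → ¬ cubeSat t c₂
  core-blocks Fj c₁ C c₂ (C⊆φ , unsat , _) c₂-def s t s⊨Fj tr t⊨c₂ =
    unsat (join s t , All.tabulate holds)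
    where
    holds : ∀ {cl} → cl ∈ C → clauseSat (join s t) cl
    holds {cl} cl∈C with ∈-++⁻ (unprimeCNF Fj ++ T) (C⊆φ cl∈C)
    ... | inj₁ cl∈FT with ∈-++⁻ (unprimeCNF Fj) cl∈FT
    ...   | inj₁ cl∈F = All.lookup (unprimeCNF⁺ (join s t) Fj s⊨Fj) cl∈F
    ...   | inj₂ cl∈T = All.lookup tr cl∈T
    holds {cl} cl∈C | inj₂ cl∈units with ∈-map⁻ _ cl∈units
    ... | l , l∈c₁ , refl = here (All.lookup t⊨c₂ (Equivalence.from (c₂-def l) (l∈c₁ , cl∈C)))

  record Invariant (i : ℕ) (F : ℕ → CNF (Fin n)) (B : ℕ → DNF (Fin n)) : Set where
    field
      F₀≡I     : F 0 ≡ I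
      F⊆P      : ∀ m → m ≤ i → ∀ s → cnfSat s (F m) → cnfSat s P
      F-step   : ∀ m → m < i → ∀ s t → cnfSat s (F m) → Trans s t → cnfSat t (F (suc m))
      ¬P⊆B₀    : ∀ t → ¬ cnfSat t P → dnfSat t (B 0)
      B-doomed : ∀ m t → dnfSat t (B m) → Doomed t
      B-bound  : ℕ
      B-empty  : ∀ m → B-bound < m → B m ≡ []
  open Invariant

  B-init : ℕ → DNF (Fin n)
  B-init m = upd (λ _ → []) 0 (negCNF P) m

  inv-start : ¬ (Σ (State n) λ s → cnfSat s I × dnfSat s (B-init 0)) → ¬ Hit (λ _ → I) B-init 0 0 →
              Invariant 1 (upd (λ _ → I) 1 P) B-init
  inv-start no-bad-init no-bad-succ = record
    { F₀≡I = refl ; F⊆P = F⊆P' ; F-step = F-step' ; ¬P⊆B₀ = λ t → ¬cnf⇒negCNF t P ; B-doomed = B-doomed'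
    ; B-bound = 0 ; B-empty = λ { (suc m) _ → refl } }
    where
    F⊆P' : ∀ m → m ≤ 1 → ∀ s → cnfSat s (upd (λ _ → I) 1 P m) → cnfSat s P
    F⊆P' zero _ s s⊨I =
      decidable-stable (cnfSat? s P) λ ¬p → no-bad-init (s , s⊨I , ¬cnf⇒negCNF s P ¬p)
    F⊆P' (suc zero) _ s s⊨P = s⊨P
    F⊆P' (suc (suc m)) (s≤s ())
    F-step' : ∀ m → m < 1 → ∀ s t → cnfSat s (upd (λ _ → I) 1 P m) → Trans s t →
              cnfSat t (upd (λ _ → I) 1 P (suc m))
    F-step' zero _ s t s⊨I tr =
      decidable-stable (cnfSat? t P) λ ¬p → no-bad-succ (s , t , s⊨I , tr , ¬cnf⇒negCNF t P ¬p)
    F-step' (suc m) (s≤s ())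
    B-doomed' : ∀ m t → dnfSat t (B-init m) → Doomed t
    B-doomed' zero t t⊨¬P = now (negCNF⇒¬cnf t P t⊨¬P)
    B-doomed' (suc m) t ()

  -- Opening F_{i+1} = P preserves the invariant once the loop has exited:
  -- with no F_i-state having a successor in ¬P ⊆ B_0, R(F_i) ⊆ P.
  inv-newFrame : ∀ {i F B} → Invariant i F B → ¬ Overlap i F B → Invariant (suc i) (upd F (suc i) P) B
  inv-newFrame {i} {F} {B} inv no-overlap = record
    { F₀≡I = F₀≡I inv ; F⊆P = F⊆P' ; F-step = F-step' ; ¬P⊆B₀ = ¬P⊆B₀ inv ; B-doomed = B-doomed inv
    ; B-bound = B-bound inv ; B-empty = B-empty inv }
    where
    F⊆P' : ∀ m → m ≤ suc i → ∀ s → cnfSat s (upd F (suc i) P m) → cnfSat s P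
    F⊆P' m m≤1+i s sat with m ≟ suc i
    ... | yes _   = sat
    ... | no m≢1+i = F⊆P inv m (≤-pred (≤∧≢⇒< m≤1+i m≢1+i)) s sat
    F-step' : ∀ m → m < suc i → ∀ s t → cnfSat s (upd F (suc i) P m) → Trans s t →
              cnfSat t (upd F (suc i) P (suc m))
    F-step' m m<1+i s t s⊨Fm tr
      with subst (cnfSat s) (upd-≢ F (suc i) P m (<⇒≢ m<1+i)) s⊨Fm | suc m ≟ suc i
    ... | s⊨Fm' | yes refl = decidable-stable (cnfSat? t P) λ ¬p →
            no-overlap (m , 0 , ≤-refl , s , t , s⊨Fm' , tr , ¬P⊆B₀ inv t ¬p)
    ... | s⊨Fm' | no 1+m≢1+i = F-step inv m (≤-pred (≤∧≢⇒< m<1+i 1+m≢1+i)) s t s⊨Fm' tr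

  inv-pushB : ∀ {i F B} → Invariant i F B → ∀ k c → (∀ t → cubeSat t c → Doomed t) →
              Invariant i F (push B (suc k) c)
  inv-pushB {i} {F} {B} inv k c c-doomed = record
    { F₀≡I = F₀≡I inv ; F⊆P = F⊆P inv ; F-step = F-step inv
    ; ¬P⊆B₀ = λ t ¬p → push-any⁺ B (suc k) c 0 (¬P⊆B₀ inv t ¬p)
    ; B-doomed = λ m t t∈ → [ c-doomed t , B-doomed inv m t ]′ (push-any⁻ B (suc k) c m t∈)
    ; B-bound = suc k + B-bound inv
    ; B-empty = λ m bound<m →
        trans (upd-≢ B (suc k) (c ∷ B (suc k)) m (λ { refl → m+n≮m (suc k) (B-bound inv) bound<m }))
              (B-empty inv m (≤-<-trans (m≤n+m (B-bound inv) (suc k)) bound<m)) }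

  inv-pushF : ∀ {i F B} → Invariant i F B → ∀ j c →
              (∀ s t → cnfSat s (F j) → Trans s t → ¬ cubeSat t c) →
              Invariant i (push F (suc j) (negCube c)) B
  inv-pushF {i} {F} {B} inv j c blocked = record
    { F₀≡I = F₀≡I inv
    ; F⊆P = λ m m≤i s sat → F⊆P inv m m≤i s (push-all⁻ F (suc j) (negCube c) m sat)
    ; F-step = F-step'
    ; ¬P⊆B₀ = ¬P⊆B₀ inv ; B-doomed = B-doomed inv ; B-bound = B-bound inv ; B-empty = B-empty inv }
    where
    F-step' : ∀ m → m < i → ∀ s t → cnfSat s (push F (suc j) (negCube c) m) → Trans s t →
              cnfSat t (push F (suc j) (negCube c) (suc m))
    F-step' m m<i s t sat tr = push-all⁺ F (suc j) (negCube c) (suc m)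
      (λ { refl → ¬cube⇒negCube t c (blocked s t s⊨Fm tr) })
      (F-step inv m m<i s t s⊨Fm tr)
      where
      s⊨Fm : cnfSat s (F m)
      s⊨Fm = push-all⁻ F (suc j) (negCube c) m sat

  hit₀-unsafe : ∀ {i F B} → Invariant i F B → ∀ k → Hit F B 0 k → NotSafe
  hit₀-unsafe inv k (s , t , s∈F₀ , tr , t∈Bk) =
    doomed-unsafe (init (subst (cnfSat s) (F₀≡I inv) s∈F₀)) (later tr (B-doomed inv k t t∈Bk))

  Covered : (ℕ → CNF (Fin n)) → ℕ → State n → Set
  Covered F j s = Σ ℕ λ m → m < j × cnfSat s (F m)

  Closes : (ℕ → CNF (Fin n)) → ℕ → Set
  Closes F j = ∀ s → cnfSat s (F j) → Covered F j s

  -- Below a closing index j, the frames cover everything reachable; since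
  -- they lie in P, a fixpoint proves safety.
  fixpoint-safe : ∀ {i F B} → Invariant i F B → FixPoint i F → Safe
  fixpoint-safe {i} {F} inv (j , j≤i , closes) s r =
    let m , m<j , s∈Fm = reach-covered s r in F⊆P inv m (≤-trans (<⇒≤ m<j) j≤i) s s∈Fm
    where
    covered-up-to-j : ∀ m s → m ≤ j → cnfSat s (F m) → Covered F j s
    covered-up-to-j m s m≤j s∈Fm with m≤n⇒m<n∨m≡n m≤j
    ... | inj₁ m<j  = m , m<j , s∈Fm
    ... | inj₂ refl = closes s s∈Fm

    reach-covered : ∀ s → Reachable s → Covered F j s
    reach-covered s (init s⊨I) = covered-up-to-j 0 s z≤n (subst (cnfSat s) (sym (F₀≡I inv)) s⊨I)
    reach-covered t (step {s} r tr) =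
      let m , m<j , s∈Fm = reach-covered s r
      in covered-up-to-j (suc m) t m<j (F-step inv m (<-≤-trans m<j j≤i) s t s∈Fm tr)

  Covered-resp : ∀ F j → Resp (Covered F j)
  Covered-resp F j s≗s' (m , m<j , sat) = m , m<j , cnfSat-resp s≗s' sat

  Covered? : ∀ F j s → Dec (Covered F j s)
  Covered? F j s = anyUpTo? (λ m → cnfSat? s (F m)) j

  closes-or-escapes : ∀ F j → Closes F j ⊎ Σ (State n) λ s → cnfSat s (F j) × ¬ Covered F j s
  closes-or-escapes F j
    with ∃-state? n (λ s → cnfSat s (F j) × ¬ Covered F j s)
           (λ s≗s' (sat , ¬cov) → cnfSat-resp s≗s' sat ,
                                  λ cov → ¬cov (Covered-resp F j (λ x → sym (s≗s' x)) cov))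
           (λ s → cnfSat? s (F j) ×-dec ¬? (Covered? F j s))
  ... | yes escape = inj₂ escape
  ... | no ¬escape = inj₁ λ s sat → decidable-stable (Covered? F j s) λ ¬cov → ¬escape (s , sat , ¬cov)

  Closes? : ∀ F j → Dec (Closes F j)
  Closes? F j with closes-or-escapes F j
  ... | inj₁ closes             = yes closes
  ... | inj₂ (s , sat , ¬cov) = no λ closes → ¬cov (closes s sat)

  FixPoint? : ∀ i F → Dec (FixPoint i F)
  FixPoint? i F with anyUpTo? (Closes? F) (suc i)
  ... | yes (j , j<1+i , closes) = yes (j , ≤-pred j<1+i , closes)
  ... | no none = no λ (j , j≤i , closes) → none (j , s≤s j≤i , closes)

  -- Without a fixpoint the unions ⋃_{m<j} F_m grow strictly for j ≤ i, so
  -- there are at most 2^n frames.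
  frames-bounded : ∀ i F → ¬ FixPoint i F → suc i ≤ 2 ^ n
  frames-bounded i F no-fixpoint = ≤-trans (lower-bound (suc i) ≤-refl) (count-≤ n _ _)
    where
    coverage : ℕ → ℕ
    coverage j = count n (Covered F j) (Covered? F j)

    grows : ∀ j → j ≤ i → coverage j < coverage (suc j)
    grows j j≤i with closes-or-escapes F j
    ... | inj₁ closes = ⊥-elim (no-fixpoint (j , j≤i , closes))
    ... | inj₂ (s , s∈Fj , ¬cov) =
      count-strict n _ _ _ _ (Covered-resp F j) (Covered-resp F (suc j))
        (λ s (m , m<j , sat) → m , m≤n⇒m≤1+n m<j , sat) s (j , ≤-refl , s∈Fj) ¬cov

    lower-bound : ∀ j → j ≤ suc i → j ≤ coverage j
    lower-bound zero    _       = z≤n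
    lower-bound (suc j) j<1+i =
      ≤-<-trans (lower-bound j (m≤n⇒m≤1+n (≤-pred j<1+i))) (grows j (≤-pred j<1+i))

  size : ℕ → (ℕ → CNF (Fin n)) → ℕ
  size i F = sumUpTo i λ m → count n (λ s → cnfSat s (F m)) (λ s → cnfSat? s (F m))

  size-shrinks : ∀ i F j c → suc j ≤ i → ∀ s → cnfSat s (F (suc j)) → cubeSat s c →
                 size i (push F (suc j) (negCube c)) < size i F
  size-shrinks i F j c j<i s s∈F s⊨c =
    sumUpTo-strict i _ _ (λ m _ → count-mono n _ _ _ _ (λ s → shrink m)) (suc j) j<i
      (count-strict n _ _ _ _ (λ s≗s' → cnfSat-resp s≗s') (λ s≗s' → cnfSat-resp s≗s')
        (λ s → shrink (suc j)) s s∈F (λ s∈F' → cube⇒¬negCube s c s⊨c (push-all-here F (suc j) (negCube c) s∈F')))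
    where
    shrink : ∀ m {s} → cnfSat s (push F (suc j) (negCube c) m) → cnfSat s (F m)
    shrink m = push-all⁻ F (suc j) (negCube c) m

  Hit? : ∀ F B j k → Dec (Hit F B j k)
  Hit? F B j k = ∃-pair? _
    (λ s≗s' t≗t' (s∈F , tr , t∈B) →
       cnfSat-resp s≗s' s∈F , Trans-resp s≗s' t≗t' tr , dnfSat-resp t≗t' t∈B)
    (λ s t → cnfSat? s (F j) ×-dec cnfSat? (join s t) T ×-dec dnfSat? t (B k))

  hit-bounded : ∀ {i F B j k} (inv : Invariant i F B) → Hit F B j k → k ≤ B-bound inv
  hit-bounded {k = k} inv (s , t , _ , _ , t∈Bk) with k ≤? B-bound inv
  ... | yes k≤bound = k≤bound
  ... | no k≰bound with subst (dnfSat t) (B-empty inv k (≰⇒> k≰bound)) t∈Bk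
  ...   | ()

  hit-at? : ∀ {i F B} → Invariant i F B → ∀ j → Dec (Σ ℕ (Hit F B j))
  hit-at? {F = F} {B} inv j with anyUpTo? (Hit? F B j) (suc (B-bound inv))
  ... | yes (k , _ , hit) = yes (k , hit)
  ... | no none = no λ (k , hit) → none (k , s≤s (hit-bounded inv hit) , hit)

  φ₂clauses-sat : ∀ Fj c a → cnfSat a (φ₂clauses Fj c) → φ₂ Fj c a
  φ₂clauses-sat Fj c a sat with All.++⁻ (unprimeCNF Fj ++ T) sat
  ... | FT , units with All.++⁻ (unprimeCNF Fj) FT
  ...   | F' , T' = unprimeCNF⁻ a Fj F' , T' , primedUnits⁻ a c units

  -- Given the partial assignment A₁ of step (iii), steps (v)–(vii) can
  -- always be carried out: a full satisfying assignment is a partial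
  -- assignment, and unsatisfiable clause sets have minimal cores.
  refine-progress : ∀ {i F B} j k → suc j ≤ i → Hit F B (suc j) k →
                    (∀ j' k' → j' < suc j → ¬ Hit F B j' k') →
                    ∀ A₁ → IsPartialAssignment (φ₁ (F (suc j)) (B k)) A₁ →
                    Σ (Config n) (run i F B loop ⟶_)
  refine-progress {F = F} j k j<i hit below A₁ pa₁
    with ∃-assignment? (φ₂ (F j) (restrictX A₁)) (Pre-resp (F j) λ t≗t' → cubeSat-resp t≗t')
                       (Pre? (F j) λ t → cubeSat? t (restrictX A₁))
  ... | yes (a , sat) = _ , loop-sat j k A₁ (literals a) j<i hit below pa₁
                              (full-partial _ (Pre-resp (F j) λ t≗t' → cubeSat-resp t≗t') a sat)
  ... | no unsat with muc _≟c_ satisfiable? (φ₂clauses (F j) (restrictX A₁))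
                        (λ (a , sat) → unsat (a , φ₂clauses-sat (F j) (restrictX A₁) a sat))
  ...   | C , core = _ , loop-unsat j k A₁ C (coreCube (restrictX A₁) C) j<i hit below pa₁ unsat core
                           (coreCube-def (restrictX A₁) C)

  -- Step (b) can always be carried out; step (iii) takes the full
  -- assignment of a hit as its partial assignment.
  loop-progress : ∀ {i F B} → Invariant i F B → Σ (Config n) (run i F B loop ⟶_)
  loop-progress {i} {F} {B} inv with least? (hit-at? inv) i
  ... | inj₂ none = _ , loop-exit λ (j , k , j≤i , hit) → none j j≤i (k , hit)
  ... | inj₁ (zero , _ , (k , hit) , _) = _ , loop-unsafe k hit
  ... | inj₁ (suc j , j<i , (k , hit@(s , t , s∈F , tr , t∈B)) , below) =
    refine-progress j k j<i hit (λ j' k' j'<j hit' → below j' j'<j (k' , hit')) (literals (join s t))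
      (full-partial _ (Pre-resp (F (suc j)) λ t≗t' → dnfSat-resp t≗t') (join s t) (s∈F , tr , t∈B))

  pa-doomed : ∀ Fj Q A → (∀ t → Q t → Doomed t) → IsPartialAssignment (Pre Fj Q) A →
              ∀ s → cubeSat s (restrictX A) → Doomed s
  pa-doomed Fj Q A Q-doomed pa s s⊨c =
    let t , tr , q = pa-successor Fj Q A pa s s⊨c in later tr (Q-doomed t q)

  sat-hit : ∀ F B j k c₁ c₂ A₂ → IsPartialAssignment (φ₂ (F j) c₁) A₂ →
            Hit F (push (push B (suc k) c₁) (suc (suc k)) c₂) j (suc k)
  sat-hit F B j k c₁ c₂ A₂ ((a , (s∈F , tr , t⊨c₁) , _) , _) =
    unprimedPart a , primedPart a , s∈F , cnfSat-resp (join-η a) tr ,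
    push-any⁺ (push B (suc k) c₁) (suc (suc k)) c₂ (suc k) (push-here B (suc k) c₁ t⊨c₁)

  -- The cube c₂ ⊆ c₁ blocked in step (vii) meets F_{j+1} (at the state of
  -- the partial assignment A₁), so blocking it shrinks the frames.
  blocking-shrinks : ∀ {i} {F : ℕ → CNF (Fin n)} {B : ℕ → DNF (Fin n)} j k A₁ (C : CNF (VV' n)) c₂ →
                     suc j ≤ i → IsPartialAssignment (φ₁ (F (suc j)) (B k)) A₁ →
                     (∀ l → (l ∈ c₂) ⇔ (l ∈ restrictX A₁ × (renLit inj₂ l ∷ []) ∈ C)) →
                     size i (push F (suc j) (negCube c₂)) < size i F
  blocking-shrinks {i} {F} j k A₁ C c₂ j<i ((a , (s∈F , _) , a⊨A₁) , _) c₂-def =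
    size-shrinks i F j c₂ j<i (unprimedPart a) s∈F
      (All.tabulate λ l∈c₂ → All.lookup (restrictX-sat A₁ a⊨A₁) (proj₁ (Equivalence.to (c₂-def _) l∈c₂)))

  HitWithin : ℕ → (ℕ → CNF (Fin n)) → (ℕ → DNF (Fin n)) → ℕ → Set
  HitWithin i F B d = Overlap i F B → Σ ℕ λ j → Σ ℕ λ k → j ≤ d × Hit F B j k

  least-below : ∀ {i F B d} j k → suc j ≤ i → Hit F B (suc j) k →
                (∀ j' k' → j' < suc j → ¬ Hit F B j' k') → HitWithin i F B d → j < d
  least-below j k j<i hit below within with within (suc j , k , j<i , hit)
  ... | j' , k' , j'≤d , hit' with suc j ≤? j'
  ...   | yes 1+j≤j' = ≤-trans 1+j≤j' j'≤d
  ...   | no 1+j≰j'  = ⊥-elim (below j' k' (≰⇒> 1+j≰j') hit')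

  -- Certificates: the invariant together with the measure
  -- (2^n ∸ i, size of the F-frames, rank of the phase), where the loop with
  -- hit bound d ranks 2 + d, above the fixpoint check (1), above opening a
  -- new frame (0).
  data Cert : Run n → Measure → Set where
    at-start    : Cert (run 0 (λ _ → I) B-init start) (suc (2 ^ n) , 0 , 0)
    in-loop     : ∀ {i F B} d → Invariant i F B → HitWithin i F B d →
                  Cert (run i F B loop) (2 ^ n ∸ i , size i F , 2 + d)
    at-check    : ∀ {i F B} → Invariant i F B → ¬ Overlap i F B →
                  Cert (run i F B fixCheck) (2 ^ n ∸ i , size i F , 1)
    at-newFrame : ∀ {i F B} → Invariant i F B → ¬ Overlap i F B → ¬ FixPoint i F →
                  Cert (run i F B newFrame) (2 ^ n ∸ i , size i F , 0)

  open Certified _⟶_ Correct _<ₘ_ Cert public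

  progress : ∀ {r μ} → Cert r μ → Σ (Config n) (r ⟶_)
  progress at-start
    with ∃-state? n (λ s → cnfSat s I × dnfSat s (B-init 0))
           (λ s≗s' (s⊨I , s∈B) → cnfSat-resp s≗s' s⊨I , dnfSat-resp s≗s' s∈B)
           (λ s → cnfSat? s I ×-dec dnfSat? s (B-init 0))
       | Hit? (λ _ → I) B-init 0 0
  ... | yes bad | _      = _ , start-unsafe (inj₁ bad)
  ... | no _    | yes hit = _ , start-unsafe (inj₂ hit)
  ... | no ¬bad | no ¬hit = _ , start-go ¬bad ¬hit
  progress (in-loop _ inv _) = loop-progress inv
  progress (at-check {i} {F} _ _) with FixPoint? i F
  ... | yes fixpoint = _ , fix-safe fixpoint
  ... | no ¬fixpoint = _ , fix-go ¬fixpoint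
  progress (at-newFrame _ _ _) = _ , new-frame

  advance : ∀ {r μ c} → Cert r μ → r ⟶ c → Next μ c
  advance at-start (start-unsafe (inj₁ (s , s⊨I , s∈B₀))) =
    unsafe-correct (doomed-unsafe (init s⊨I) (now (negCNF⇒¬cnf s P s∈B₀)))
  advance at-start (start-unsafe (inj₂ (s , t , s⊨I , tr , t∈B₀))) =
    unsafe-correct (doomed-unsafe (init s⊨I) (later tr (now (negCNF⇒¬cnf t P t∈B₀))))
  advance at-start (start-go ¬bad ¬hit) =
    _ , inj₁ (s≤s (m∸n≤m (2 ^ n) 1)) , in-loop 1 (inv-start ¬bad ¬hit) id
  advance (in-loop d inv within) (loop-exit no-overlap) =
    _ , inj₂ (refl , inj₂ (refl , s≤s (s≤s z≤n))) , at-check inv no-overlap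
  advance (in-loop d inv within) (loop-unsafe k hit) = unsafe-correct (hit₀-unsafe inv k hit)
  advance (in-loop {F = F} {B} d inv within) (loop-sat j k A₁ A₂ j<i hit below pa₁ pa₂) =
    _ , inj₂ (refl , inj₂ (refl , s≤s (s≤s (least-below j k j<i hit below within)))) ,
    in-loop j (inv-pushB (inv-pushB inv k c₁ c₁-doomed) (suc k) (restrictX A₂) c₂-doomed)
      λ _ → j , suc k , ≤-refl , sat-hit F B j k c₁ (restrictX A₂) A₂ pa₂
    where
    c₁ : Cube (Fin n)
    c₁ = restrictX A₁
    c₁-doomed : ∀ t → cubeSat t c₁ → Doomed t
    c₁-doomed = pa-doomed (F (suc j)) (λ t → dnfSat t (B k)) A₁ (B-doomed inv k) pa₁
    c₂-doomed : ∀ t → cubeSat t (restrictX A₂) → Doomed t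
    c₂-doomed = pa-doomed (F j) (λ t → cubeSat t c₁) A₂ c₁-doomed pa₂
  advance (in-loop {i} {F} {B} d inv within) (loop-unsat j k A₁ C c₂ j<i hit below pa₁ _ core c₂-def) =
    _ , inj₂ (refl , inj₁ (blocking-shrinks {B = B} j k A₁ C c₂ j<i pa₁ c₂-def)) ,
    in-loop i (inv-pushF (inv-pushB inv k c₁ c₁-doomed) j c₂ (core-blocks (F j) c₁ C c₂ core c₂-def))
      id
    where
    c₁ : Cube (Fin n)
    c₁ = restrictX A₁
    c₁-doomed : ∀ t → cubeSat t c₁ → Doomed t
    c₁-doomed = pa-doomed (F (suc j)) (λ t → dnfSat t (B k)) A₁ (B-doomed inv k) pa₁
  advance (at-check inv no-overlap) (fix-safe fixpoint) = safe-correct (fixpoint-safe inv fixpoint)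
  advance (at-check inv no-overlap) (fix-go ¬fixpoint) =
    _ , inj₂ (refl , inj₂ (refl , s≤s z≤n)) , at-newFrame inv no-overlap ¬fixpoint
  advance (at-newFrame {i} {F} inv no-overlap ¬fixpoint) new-frame =
    _ , inj₁ (∸-monoʳ-< (n<1+n i) (frames-bounded i F ¬fixpoint)) ,
    in-loop (suc i) (inv-newFrame inv no-overlap) id

theorem3 : (n : ℕ) (I : CNF (Fin n)) (T : CNF (VV' n)) (P : CNF (Fin n)) →
    AllRunsTerminate (CAR._⟶_ I T P) (CAR.Correct I T P) (CAR.initial I T P)
theorem3 n I T P = terminates progress advance (<ₘ-wellFounded _) at-start
  where open ForwardCAR I T P
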